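{- Let $G$ be a connected graph of order $n$ and $k\ge\chi(G)$ an integer. Then $\overline{\mathrm{scs}}(G,k)=n$ if and only if $k>\chi(G)$; likewise $\overline{\mathrm{lcs}}(G,k)=n$ if and only if $k>\chi(G)$.
   Context: For a graph $G=(V,E)$ and an integer $k\ge\chi(G)$, a proper $k$-colouring is a map $c\colon V\to\{1,\dots,k\}$ with adjacent vertices receiving different colours. A determining set for $(G,c)$ is a set $S\subseteq V$ such that there is no proper $k$-colouring $c'\neq c$ of $G$ with $c'(s)=c(s)$ for all $s\in S$. A critical set for $(G,c)$ is an inclusion-minimal determining set. $\mathrm{scs}(G,c)$ and $\mathrm{lcs}(G,c)$ denote the minimum and maximum size of a critical set for $(G,c)$. $\overline{\mathrm{scs}}(G,k)$ and $\overline{\mathrm{lcs}}(G,k)$ are the maxima of $\mathrm{scs}(G,c)$ resp. $\mathrm{lcs}(G,c)$ over all proper $k$-colourings $c$ of $G$. -}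

module Defs where

open import Data.Nat using (ℕ; _≤_; _<_)
open import Data.Fin using (Fin)
open import Data.Fin.Subset using (Subset; _∈_; _⊆_; ∣_∣)
open import Data.Product using (Σ; ∃; _×_; _,_)
open import Relation.Nullary using (¬_)
open import Relation.Binary.PropositionalEquality using (_≡_)
open import Level using (0ℓ)

record Graph (n : ℕ) : Set₁ where
  field
    Adj    : Fin n → Fin n → Set
    sym    : ∀ {u v} → Adj u v → Adj v u
    irrefl : ∀ {u} → ¬ Adj u u
open Graph public

data Walk {n : ℕ} (G : Graph n) : Fin n → Fin n → Set where
  here : ∀ {u} → Walk G u u
  step : ∀ {u v w} → Adj G u v → Walk G v w → Walk G u w

Connected : {n : ℕ} → Graph n → Set
Connected G = ∀ u v → Walk G u v

Colouring : ℕ → ℕ → Set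
Colouring n k = Fin n → Fin k

Proper : {n k : ℕ} → Graph n → Colouring n k → Set
Proper G c = ∀ {u v} → Adj G u v → ¬ (c u ≡ c v)

Colourable : {n : ℕ} → Graph n → ℕ → Set
Colourable {n} G k = Σ (Colouring n k) (Proper G)

IsChromaticNumber : {n : ℕ} → Graph n → ℕ → Set
IsChromaticNumber G χ = Colourable G χ × (∀ j → j < χ → ¬ Colourable G j)

Determining : {n k : ℕ} → Graph n → Colouring n k → Subset n → Set
Determining {n} {k} G c S =
  (c' : Colouring n k) → Proper G c' → (∀ s → s ∈ S → c' s ≡ c s) → ∀ v → c' v ≡ c v

Critical : {n k : ℕ} → Graph n → Colouring n k → Subset n → Set
Critical G c S = Determining G c S × (∀ T → T ⊆ S → Determining G c T → T ≡ S)

IsScs : {n k : ℕ} → Graph n → Colouring n k → ℕ → Set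
IsScs {n} G c m = (Σ (Subset n) λ S → Critical G c S × ∣ S ∣ ≡ m)
                × (∀ S → Critical G c S → m ≤ ∣ S ∣)

IsLcs : {n k : ℕ} → Graph n → Colouring n k → ℕ → Set
IsLcs {n} G c m = (Σ (Subset n) λ S → Critical G c S × ∣ S ∣ ≡ m)
                × (∀ S → Critical G c S → ∣ S ∣ ≤ m)

IsScsBar : {n : ℕ} → Graph n → ℕ → ℕ → Set
IsScsBar {n} G k m =
  (Σ (Colouring n k) λ c → Proper G c × IsScs G c m)
  × (∀ (c : Colouring n k) → Proper G c → ∀ m' → IsScs G c m' → m' ≤ m)

IsLcsBar : {n : ℕ} → Graph n → ℕ → ℕ → Set
IsLcsBar {n} G k m =
  (Σ (Colouring n k) λ c → Proper G c × IsLcs G c m)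
  × (∀ (c : Colouring n k) → Proper G c → ∀ m' → IsLcs G c m' → m' ≤ m)

{-# OPTIONS --safe #-}
module Submission where

open import Defs hiding (sym)
open import Data.Nat using (ℕ; _≤_; _<_; suc)
open import Data.Nat.Properties using (≤-refl; ≤-reflexive; ≤∧≢⇒<)
open import Data.Product using (_×_; _,_; Σ; ∃; proj₁; proj₂)
open import Data.Sum using (_⊎_; inj₁; inj₂)
open import Function using (const; _∘_)
open import Function.Bundles using (_⇔_; mk⇔)
open import Data.Fin using (Fin; zero; inject≤; inject₁; fromℕ; punchOut; _≟_)
open import Data.Fin.Properties
  using (inject≤-injective; inject₁-injective; fromℕ≢inject₁; punchOut-injective; sequence)
open import Data.Fin.Subset using (Subset; _∈_; ∣_∣; ⊤; ∁; ⁅_⁆)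
open import Data.Fin.Subset.Properties
  using ( _∈?_; ∈⊤; ⊆⊤; ⊆-antisym; ∣p∣≤n; ∣⊤∣≡n; ∣p∣≡n⇒p≡⊤
        ; x∈⁅x⁆; x≢y⇒x∉⁅y⁆; x∈∁p⇒x∉p; x∉p⇒x∈∁p)
open import Data.Vec.Functional using (updateAt)
open import Data.Vec.Functional.Properties using (updateAt-updates; updateAt-minimal)
open import Effect.Monad using (RawMonad)
open import Relation.Nullary using (¬_; yes; no; contradiction)
open import Relation.Nullary.Negation using (¬¬-Monad)
open import Relation.Binary.PropositionalEquality using (_≡_; _≢_; refl; sym; trans; cong; subst)

-- A vertex v is recolourable in c if some other colour is absent from its neighbourhood.
-- A recolourable vertex lies in every determining set. If c misses a colour altogether,
-- every vertex is recolourable, so V is the only determining, hence the only critical, set.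
-- Conversely, if V is critical then for each v the set V ∖ {v} does not determine c, which
-- forces v to be recolourable; recolouring every vertex of one colour class (an independent
-- set) then yields a colouring with one colour fewer, so c cannot use only χ colours.

¬¬-∀-Fin : ∀ {n} {P : Fin n → Set} → (∀ i → ¬ ¬ P i) → ¬ ¬ (∀ i → P i)
¬¬-∀-Fin = sequence (RawMonad.rawApplicative ¬¬-Monad)

≢⇒∈∁⁅_⁆ : ∀ {n} (v : Fin n) {u} → u ≢ v → u ∈ ∁ ⁅ v ⁆
≢⇒∈∁⁅ v ⁆ = x∉p⇒x∈∁p ∘ x≢y⇒x∉⁅y⁆

CriticalOfSize : {n k : ℕ} → Graph n → Colouring n k → ℕ → Set
CriticalOfSize {n} G c m = Σ (Subset n) λ S → Critical G c S × ∣ S ∣ ≡ m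

module _ {n k : ℕ} (G : Graph n) where

  FreeAt : Colouring n k → Fin n → Fin k → Set
  FreeAt c v j = ∀ w → Adj G v w → c w ≢ j

  Recolourable : Colouring n k → Fin n → Set
  Recolourable c v = ∃ λ j → j ≢ c v × FreeAt c v j

  recolour : Colouring n k → Fin n → Fin k → Colouring n k
  recolour c v j = updateAt c v (const j)

  recolour-proper : ∀ {c v j} → Proper G c → FreeAt c v j → Proper G (recolour c v j)
  recolour-proper {c} {v} {j} pc free {u} {w} u~w with u ≟ v | w ≟ v
  ... | yes refl | yes refl = contradiction u~w (irrefl G)
  ... | yes refl | no w≢v
    rewrite updateAt-updates v {const j} c | updateAt-minimal w v {const j} c w≢v
    = free w u~w ∘ sym
  ... | no u≢v | yes refl
    rewrite updateAt-minimal u v {const j} c u≢v | updateAt-updates v {const j} c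
    = free u (Graph.sym G u~w)
  ... | no u≢v | no w≢v
    rewrite updateAt-minimal u v {const j} c u≢v | updateAt-minimal w v {const j} c w≢v
    = pc u~w

  recolourable⇒∈-determining : ∀ {c v S} → Proper G c → Recolourable c v → Determining G c S → v ∈ S
  recolourable⇒∈-determining {c} {v} {S} pc (j , j≢cv , free) det with v ∈? S
  ... | yes v∈S = v∈S
  ... | no  v∉S = contradiction recoloured-v j≢cv
    where
    agree : ∀ s → s ∈ S → recolour c v j s ≡ c s
    agree s s∈S = updateAt-minimal s v c λ { refl → v∉S s∈S }

    recoloured-v : j ≡ c v
    recoloured-v = trans (sym (updateAt-updates v c)) (det _ (recolour-proper pc free) agree v)

  missingColour⇒determining≡⊤ : ∀ {c j S} → Proper G c → (∀ v → j ≢ c v) →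
                                Determining G c S → S ≡ ⊤
  missingColour⇒determining≡⊤ pc missing det =
    ⊆-antisym ⊆⊤ λ {v} _ → recolourable⇒∈-determining pc (_ , missing v , λ w _ → missing w ∘ sym) det

  ⊤-determining : ∀ {c : Colouring n k} → Determining G c ⊤
  ⊤-determining _ _ agree v = agree v ∈⊤

  module _ {c : Colouring n k} (⊤-only-determining : ∀ S → Determining G c S → S ≡ ⊤) where

    ⊤-critical : Critical G c ⊤
    ⊤-critical = ⊤-determining , λ T _ → ⊤-only-determining T

    ⊤-only-determining⇒IsScs : IsScs G c n
    ⊤-only-determining⇒IsScs = (⊤ , ⊤-critical , ∣⊤∣≡n n) , λ S (det , _) →
      ≤-reflexive (trans (sym (∣⊤∣≡n n)) (cong ∣_∣ (sym (⊤-only-determining S det))))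

    ⊤-only-determining⇒IsLcs : IsLcs G c n
    ⊤-only-determining⇒IsLcs = (⊤ , ⊤-critical , ∣⊤∣≡n n) , λ S _ → ∣p∣≤n S

  criticalOfSize-n⇒⊤-critical : ∀ {c : Colouring n k} → CriticalOfSize G c n → Critical G c ⊤
  criticalOfSize-n⇒⊤-critical {c} (S , crit , ∣S∣≡n) = subst (Critical G c) (∣p∣≡n⇒p≡⊤ ∣S∣≡n) crit

  criticalOfSize⇒≤n : ∀ {c : Colouring n k} {m} → CriticalOfSize G c m → m ≤ n
  criticalOfSize⇒≤n (S , _ , ∣S∣≡m) = subst (_≤ n) ∣S∣≡m (∣p∣≤n S)

  unrecolourable⇒∁⁅v⁆-determining : ∀ {c v} → ¬ Recolourable c v → Determining G c (∁ ⁅ v ⁆)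
  unrecolourable⇒∁⁅v⁆-determining {c} {v} stuck c' pc' agree u with u ≟ v
  ... | no u≢v = agree u (≢⇒∈∁⁅ v ⁆ u≢v)
  ... | yes refl with c' u ≟ c u
  ...   | yes same = same
  ...   | no differ = contradiction (c' u , differ , free) stuck
    where
    free : FreeAt c u (c' u)
    free w u~w cw≡c'u = pc' u~w (sym (trans (agree w w∈∁⁅u⁆) cw≡c'u))
      where
      w∈∁⁅u⁆ : w ∈ ∁ ⁅ u ⁆
      w∈∁⁅u⁆ = ≢⇒∈∁⁅ u ⁆ λ { refl → irrefl G u~w }

  ⊤-critical⇒recolourable : ∀ {c : Colouring n k} → Critical G c ⊤ → ∀ v → ¬ ¬ Recolourable c v
  ⊤-critical⇒recolourable (_ , minimal) v stuck = x∈∁p⇒x∉p (subst (v ∈_) (sym ∁⁅v⁆≡⊤) ∈⊤) (x∈⁅x⁆ v)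
    where
    ∁⁅v⁆≡⊤ : ∁ ⁅ v ⁆ ≡ ⊤
    ∁⁅v⁆≡⊤ = minimal (∁ ⁅ v ⁆) ⊆⊤ (unrecolourable⇒∁⁅v⁆-determining stuck)

module _ {n k : ℕ} (G : Graph n) where

  Evictable : Colouring n (suc k) → Fin (suc k) → Fin n → Set
  Evictable c i v = i ≢ c v ⊎ (c v ≡ i × ∃ λ j → i ≢ j × FreeAt G c v j)

  evictColour : ∀ {c} i → Proper G c → (∀ v → Evictable c i v) → Colourable G k
  evictColour {c} i pc evictable = c* , pc*
    where
    c* : Colouring n k
    c* v with evictable v
    ... | inj₁ i≢cv = punchOut i≢cv
    ... | inj₂ (_ , _ , i≢j , _) = punchOut i≢j

    pc* : Proper G c*
    pc* {u} {w} u~w with evictable u | evictable w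
    ... | inj₁ i≢cu | inj₁ i≢cw = pc u~w ∘ punchOut-injective i≢cu i≢cw
    ... | inj₂ (_ , _ , i≢j , free) | inj₁ i≢cw = free w u~w ∘ sym ∘ punchOut-injective i≢j i≢cw
    ... | inj₁ i≢cu | inj₂ (_ , _ , i≢j , free) = free u (Graph.sym G u~w) ∘ punchOut-injective i≢cu i≢j
    ... | inj₂ (cu≡i , _) | inj₂ (cw≡i , _) = λ _ → pc u~w (trans cu≡i (sym cw≡i))

  ⊤-critical⇒evictable : ∀ {c : Colouring n (suc k)} → Critical G c ⊤ → ∀ i v → ¬ ¬ Evictable c i v
  ⊤-critical⇒evictable {c} crit i v with i ≟ c v
  ... | no i≢cv = λ ¬evictable → ¬evictable (inj₁ i≢cv)
  ... | yes refl = λ ¬evictable → ⊤-critical⇒recolourable G crit v λ (j , j≢cv , free) →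
                     ¬evictable (inj₂ (refl , j , j≢cv ∘ sym , free))

-- The colouring with one colour fewer exists only under ¬¬ (adjacency is not decidable),
-- which suffices since the goal is a negation.
⊤-critical⇒¬minimal : ∀ {n k} (G : Graph n) → 1 ≤ n → (c : Colouring n k) → Proper G c →
                      Critical G c ⊤ → ¬ (∀ j → j < k → ¬ Colourable G j)
⊤-critical⇒¬minimal {suc _} {0} G _ c _ _ _ with c zero
... | ()
⊤-critical⇒¬minimal {suc _} {suc k} G _ c pc crit below =
  ¬¬-∀-Fin (⊤-critical⇒evictable G crit zero) (below k ≤-refl ∘ evictColour G zero pc)

colourable⇒colouringMissingAColour : ∀ {n χ k} (G : Graph n) → Colourable G χ → χ < k →
                                     Σ (Colouring n k) λ c → Proper G c × ∃ λ j → ∀ v → j ≢ c v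
colourable⇒colouringMissingAColour {χ = χ} G (c , pc) χ<k = c⁺ , pc⁺ , inject≤ (fromℕ χ) χ<k , spare≢
  where
  c⁺ : Colouring _ _
  c⁺ v = inject≤ (inject₁ (c v)) χ<k

  pc⁺ : Proper G c⁺
  pc⁺ u~w = pc u~w ∘ inject₁-injective ∘ inject≤-injective χ<k χ<k _ _

  spare≢ : ∀ v → inject≤ (fromℕ χ) χ<k ≢ c⁺ v
  spare≢ v = fromℕ≢inject₁ ∘ inject≤-injective χ<k χ<k _ _

module _ {n k : ℕ} (G : Graph n) where

  colourable-below⇒bars≡n : ∀ {χ} → Colourable G χ → χ < k → IsScsBar G k n × IsLcsBar G k n
  colourable-below⇒bars≡n col χ<k with colourable⇒colouringMissingAColour G col χ<k
  ... | c , pc , _ , missing =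
    ((c , pc , ⊤-only-determining⇒IsScs G ⊤-only-determining) , λ _ _ _ (size , _) → criticalOfSize⇒≤n G size) ,
    ((c , pc , ⊤-only-determining⇒IsLcs G ⊤-only-determining) , λ _ _ _ (size , _) → criticalOfSize⇒≤n G size)
    where
    ⊤-only-determining : ∀ S → Determining G c S → S ≡ ⊤
    ⊤-only-determining S = missingColour⇒determining≡⊤ G pc missing

  criticalOfSize-n⇒χ<k : ∀ {χ} {c : Colouring n k} → 1 ≤ n → IsChromaticNumber G χ → χ ≤ k →
                         Proper G c → CriticalOfSize G c n → χ < k
  criticalOfSize-n⇒χ<k 1≤n (_ , below-χ) χ≤k pc size-n = ≤∧≢⇒< χ≤k λ { refl →
    ⊤-critical⇒¬minimal G 1≤n _ pc (criticalOfSize-n⇒⊤-critical G size-n) below-χ }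

mainTheorem4 : (n : ℕ) → 1 ≤ n → (G : Graph n) → Connected G →
    (χ : ℕ) → IsChromaticNumber G χ → (k : ℕ) → χ ≤ k →
    (IsScsBar G k n ⇔ χ < k) × (IsLcsBar G k n ⇔ χ < k)
mainTheorem4 n 1≤n G _ χ chromatic k χ≤k =
  mk⇔ (λ ((_ , pc , size-n , _) , _) → χ<k pc size-n) (proj₁ ∘ bars≡n) ,
  mk⇔ (λ ((_ , pc , size-n , _) , _) → χ<k pc size-n) (proj₂ ∘ bars≡n)
  where
  χ<k : ∀ {c : Colouring n k} → Proper G c → CriticalOfSize G c n → χ < k
  χ<k = criticalOfSize-n⇒χ<k G 1≤n chromatic χ≤k

  bars≡n : χ < k → IsScsBar G k n × IsLcsBar G k n
  bars≡n = colourable-below⇒bars≡n G (proj₁ chromatic)
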